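{- Let $G$ be a finite simple graph, let $S\subseteq V(G)$ be $G$-admissible (i.e. $P(S;G)\neq\emptyset$), and let $L$ be a set of vertices with $V_{<2}(G)\subseteq L\subseteq V(G)$. Then the set of labelings output by the procedure $\mathcal A(G,S,L)$ is exactly $P(S,G,L)$.
   Context: For a finite simple graph $G$ with $N$ vertices, a labeling is a bijection $\ell:V(G)\to\{1,\ldots,N\}$; $\ell$ has a peak at $v$ if $\deg_G(v)\ge 2$ and $\ell(v)>\ell(w)$ for all neighbors $w$ of $v$. The peak set of $\ell$ is the set of its peaks; $P(S;G)$ is the set of labelings with peak set exactly $S$. $N_G(v)$ is the set of neighbors of $v$ in $G$, and $N_G(S)=\bigcup_{v\in S}N_G(v)$. $V_{<2}(G)$ is the set of vertices of $G$ of degree less than $2$. For $V_{<2}(G)\subseteq L\subseteq V(G)$, $P(S,G,L)$ is the set of labelings of $G$ whose peak set $S'$ satisfies $S\subseteq S'\subseteq S\cup (L\setminus N_G(S))$. For $v\in V(G)$, $G\setminus\{v\}$ is the graph obtained by deleting $v$ and its incident edges. The procedure $\mathcal A(G,S,L)$ (the Graph Peak Set Algorithm) returns a set of labelings of $G$ defined recursively: if $V(G)=\emptyset$ it returns the single empty labeling; otherwise, for each vertex $v\in S\cup(L\setminus N_G(S))$, set $S_v=S\setminus\{v\}$ and $L_v=(L\cup N_G(v))\setminus\{v\}$, and for every labeling $\ell'$ of $G\setminus\{v\}$ output by $\mathcal A(G\setminus\{v\},S_v,L_v)$, output the labeling $\ell$ of $G$ given by $\ell(v)=|V(G)|$ and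 $\ell(w)=\ell'(w)$ for $w\neq v$. The output of $\mathcal A(G,S,L)$ is the union over all such choices of $v$. -}

module Defs where

open import Data.Nat using (ℕ; _≤_; _<_; _>_)
open import Data.Bool using (Bool; true; false)
open import Data.Fin using (Fin)
open import Data.Fin.Subset using (Subset; _∈_; _∉_; _∪_; _∩_; _-_; ⁅_⁆; ∣_∣; ⊤; ⊥)
open import Data.Vec using (tabulate)
open import Data.Product using (Σ; ∃; _×_; _,_)
open import Data.Sum using (_⊎_)
open import Relation.Nullary using (¬_)
open import Relation.Binary.PropositionalEquality using (_≡_)
open import Function.Bundles using (_⇔_)

Adjacency : ℕ → Set
Adjacency n = Fin n → Fin n → Bool

IsSimpleGraph : {n : ℕ} → Adjacency n → Set
IsSimpleGraph {n} E =
  (∀ (v w : Fin n) → E v w ≡ E w v) × (∀ (v : Fin n) → E v v ≡ false)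

module _ {n : ℕ} (E : Adjacency n) where

  nbrsIn : Subset n → Fin n → Subset n
  nbrsIn W v = tabulate (λ w → E v w) ∩ W

  InNbhdIn : Subset n → Subset n → Fin n → Set
  InNbhdIn W S w = ∃ λ s → s ∈ S × s ∈ W × w ∈ W × E s w ≡ true

  deg : Fin n → ℕ
  deg v = ∣ nbrsIn ⊤ v ∣

  IsLabeling : (Fin n → ℕ) → Set
  IsLabeling ℓ =
    (∀ v → 1 ≤ ℓ v × ℓ v ≤ n) ×
    (∀ v w → ℓ v ≡ ℓ w → v ≡ w) ×
    (∀ k → 1 ≤ k → k ≤ n → ∃ λ v → ℓ v ≡ k)

  IsPeak : (Fin n → ℕ) → Fin n → Set
  IsPeak ℓ v = 2 ≤ deg v × (∀ w → E v w ≡ true → ℓ v > ℓ w)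

  HasPeakSet : Subset n → (Fin n → ℕ) → Set
  HasPeakSet S ℓ = IsLabeling ℓ × (∀ v → IsPeak ℓ v ⇔ v ∈ S)

  Admissible : Subset n → Set
  Admissible S = ∃ λ ℓ → HasPeakSet S ℓ

  -- ℓ ∈ P(S,G,L): peak set S' with S ⊆ S' ⊆ S ∪ (L ∖ N_G(S)).
  InPSL : Subset n → Subset n → (Fin n → ℕ) → Set
  InPSL S L ℓ =
    IsLabeling ℓ ×
    (∀ v → v ∈ S → IsPeak ℓ v) ×
    (∀ v → IsPeak ℓ v → v ∈ S ⊎ (v ∈ L × ¬ InNbhdIn ⊤ S v))

  -- Output of the Graph Peak Set Algorithm A(G[W], S, L), as a predicate on
  -- labelings.  A labeling of G[W] is represented by a function Fin n → ℕ
  -- whose values outside W are irrelevant.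
  data Alg : (W S L : Subset n) → (Fin n → ℕ) → Set where
    done : ∀ {W S L} (ℓ : Fin n → ℕ) → W ≡ ⊥ → Alg W S L ℓ
    step : ∀ {W S L} (ℓ : Fin n → ℕ) (v : Fin n) →
           v ∈ W →
           (v ∈ S ⊎ (v ∈ L × ¬ InNbhdIn W S v)) →
           ℓ v ≡ ∣ W ∣ →
           Alg (W - v) (S - v) ((L ∪ nbrsIn W v) - v) ℓ →
           Alg W S L ℓ

module Submission where

-- The proof rests on two invariants
-- that hold at every stage of a run (or of a run we construct):
--   * W is an initial segment of the labeling: W = { w | ℓ w ≤ |W| }, so the
--     removed vertices are exactly those with labels above |W|;
--   * the current parameters (S', L') track the original ones: on W, S' agrees
--     with S and L' agrees with L ∪ N(V ∖ W).
-- Soundness (Alg ⇒ P(S,G,L)): a run on V(G) assigns a bijective labeling; along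
-- the run the two invariants, together with "no vertex of S in W is adjacent to a
-- removed vertex" (which uses that S is admissible, hence independent), show that
-- each vertex of S is a peak and every other peak lies in L ∖ N(S).
-- Completeness (P(S,G,L) ⇒ Alg): given ℓ ∈ P(S,G,L), repeatedly remove the vertex
-- with the largest label; the invariants show it is always an allowed choice.

open import Defs
open import Data.Nat using (ℕ; zero; suc; _≤_; _<_; s≤s; z≤n; _≤?_)
open import Data.Nat.Properties
  using (≤-reflexive; ≤-trans; <-irrefl; <-asym; ≤-<-trans; ≤∧≢⇒<; ≰⇒>; ≤-pred; suc-injective)
  renaming (_≟_ to _≟ℕ_)
open import Data.Bool using (Bool; true; false)
open import Data.Fin using (Fin; zero; suc) renaming (_≟_ to _≟F_)
open import Data.Fin.Subset using (Subset; _∈_; _∉_; _∪_; _-_; ⁅_⁆; ∣_∣; ⊤)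
open import Data.Fin.Subset.Properties
  using (_∈?_; ∈⊤; ∉⊥; ∣⊥∣≡0; ∣⊤∣≡n; ∣p∣≤n; p─⊥≡p; p─q⊆p; ∣p─q∣≤∣p∣; x∈p⇒∣p-x∣<∣p∣;
         x∈p∧x≢y⇒x∈p-y; x∈p∪q⁺; x∈p∪q⁻; x∈p∩q⁺; x∈p∩q⁻; drop-there; Empty-unique)
open import Data.Vec using (_∷_; tabulate)
open import Data.Vec.Properties using ([]=⇒lookup; lookup⇒[]=; lookup∘tabulate)
open import Data.Empty using (⊥-elim)
open import Data.Product using (∃; _×_; _,_; proj₁; proj₂)
open import Data.Sum using (_⊎_; inj₁; inj₂)
open import Relation.Nullary using (¬_; contradiction; yes; no)
open import Relation.Binary.PropositionalEquality
  using (_≡_; _≢_; refl; sym; trans; cong; subst)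
open import Function.Bundles using (_⇔_; mk⇔; Equivalence)

private variable n : ℕ

x∉p-x : (p : Subset n) (x : Fin n) → x ∉ p - x
x∉p-x (s ∷ p) zero    ()
x∉p-x (s ∷ p) (suc x) x∈ = x∉p-x p x (drop-there x∈)

x∈p-y⇒x∈p : {p : Subset n} {x y : Fin n} → x ∈ p - y → x ∈ p
x∈p-y⇒x∈p {p = p} {y = y} = p─q⊆p p ⁅ y ⁆

x∈p-y⇒x≢y : {p : Subset n} {x y : Fin n} → x ∈ p - y → x ≢ y
x∈p-y⇒x≢y {p = p} {x = x} x∈ refl = x∉p-x p x x∈

x∉p-y⇒x∉p : {p : Subset n} {x y : Fin n} → x ∉ p - y → x ≢ y → x ∉ p
x∉p-y⇒x∉p x∉ x≢y x∈ = x∉ (x∈p∧x≢y⇒x∈p-y x∈ x≢y)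

suc∣p-x∣≡∣p∣ : (p : Subset n) (x : Fin n) → x ∈ p → suc ∣ p - x ∣ ≡ ∣ p ∣
suc∣p-x∣≡∣p∣ (true  ∷ p) zero    _  = cong (λ q → suc ∣ q ∣) (p─⊥≡p p)
suc∣p-x∣≡∣p∣ (true  ∷ p) (suc x) x∈ = cong suc (suc∣p-x∣≡∣p∣ p x (drop-there x∈))
suc∣p-x∣≡∣p∣ (false ∷ p) (suc x) x∈ = suc∣p-x∣≡∣p∣ p x (drop-there x∈)

∈-tabulate⁻ : (f : Fin n → Bool) (x : Fin n) → x ∈ tabulate f → f x ≡ true
∈-tabulate⁻ f x x∈ = trans (sym (lookup∘tabulate f x)) ([]=⇒lookup x∈)

∈-tabulate⁺ : (f : Fin n → Bool) (x : Fin n) → f x ≡ true → x ∈ tabulate f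
∈-tabulate⁺ f x fx = lookup⇒[]= x (tabulate f) (trans (lookup∘tabulate f x) fx)

-- Runs of the algorithm produce bijective labelings

module Runs {n : ℕ} (E : Adjacency n) where

  run-bounds : ∀ {W S L ℓ} → Alg E W S L ℓ → ∀ w → w ∈ W → 1 ≤ ℓ w × ℓ w ≤ ∣ W ∣
  run-bounds (done ℓ refl) w w∈ = contradiction w∈ ∉⊥
  run-bounds {W} (step ℓ v v∈ _ ℓv rest) w w∈ with w ≟F v
  ... | yes refl = ≤-trans (s≤s z≤n) (≤-trans (x∈p⇒∣p-x∣<∣p∣ v∈) (≤-reflexive (sym ℓv)))
                 , ≤-reflexive ℓv
  ... | no w≢v   = let (1≤ℓw , ℓw≤) = run-bounds rest w (x∈p∧x≢y⇒x∈p-y w∈ w≢v)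
                   in 1≤ℓw , ≤-trans ℓw≤ (∣p─q∣≤∣p∣ W ⁅ v ⁆)

  run-top : ∀ {W S L ℓ} v w → v ∈ W → ℓ v ≡ ∣ W ∣ → w ∈ W - v →
            Alg E (W - v) S L ℓ → ℓ w < ℓ v
  run-top {W} v w v∈ ℓv w∈ rest =
    ≤-<-trans (proj₂ (run-bounds rest w w∈)) (subst (∣ W - v ∣ <_) (sym ℓv) (x∈p⇒∣p-x∣<∣p∣ v∈))

  run-injective : ∀ {W S L ℓ} → Alg E W S L ℓ →
                  ∀ w w′ → w ∈ W → w′ ∈ W → ℓ w ≡ ℓ w′ → w ≡ w′
  run-injective (done ℓ refl) w w′ w∈ _ _ = contradiction w∈ ∉⊥
  run-injective (step ℓ v v∈ _ ℓv rest) w w′ w∈ w′∈ eq with w ≟F v | w′ ≟F v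
  ... | yes refl | yes refl = refl
  ... | yes refl | no w′≢v  =
    contradiction (sym eq) (λ e → <-irrefl e (run-top v w′ v∈ ℓv (x∈p∧x≢y⇒x∈p-y w′∈ w′≢v) rest))
  ... | no w≢v   | yes refl =
    contradiction eq (λ e → <-irrefl e (run-top v w v∈ ℓv (x∈p∧x≢y⇒x∈p-y w∈ w≢v) rest))
  ... | no w≢v   | no w′≢v  =
    run-injective rest w w′ (x∈p∧x≢y⇒x∈p-y w∈ w≢v) (x∈p∧x≢y⇒x∈p-y w′∈ w′≢v) eq

  run-surjective : ∀ {W S L ℓ} → Alg E W S L ℓ →
                   ∀ k → 1 ≤ k → k ≤ ∣ W ∣ → ∃ λ w → w ∈ W × ℓ w ≡ k
  run-surjective (done ℓ refl) (suc k) _ k≤ = contradiction (subst (suc k ≤_) (∣⊥∣≡0 n) k≤) λ ()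
  run-surjective {W} (step ℓ v v∈ _ ℓv rest) k 1≤k k≤ with k ≟ℕ ∣ W ∣
  ... | yes refl = v , v∈ , ℓv
  ... | no k≢    =
    let k≤∣W-v∣ = ≤-pred (subst (k <_) (sym (suc∣p-x∣≡∣p∣ W v v∈)) (≤∧≢⇒< k≤ k≢))
        (w , w∈ , ℓw) = run-surjective rest k 1≤k k≤∣W-v∣
    in w , x∈p-y⇒x∈p w∈ , ℓw

  run-labeling : ∀ {S L ℓ} → Alg E ⊤ S L ℓ → IsLabeling E ℓ
  run-labeling r =
      (λ v → let (1≤ℓv , ℓv≤) = run-bounds r v ∈⊤ in 1≤ℓv , subst (_ ≤_) (∣⊤∣≡n n) ℓv≤)
    , (λ v w → run-injective r v w ∈⊤ ∈⊤)
    , (λ k 1≤k k≤n → let (w , _ , ℓw) = run-surjective r k 1≤k (subst (k ≤_) (sym (∣⊤∣≡n n)) k≤n)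
                     in w , ℓw)

module SimpleGraph {n : ℕ} (E : Adjacency n) (simple : IsSimpleGraph E) where

  adjacent-sym : ∀ v w → E v w ≡ true → E w v ≡ true
  adjacent-sym v w e = trans (proj₁ simple w v) e

  adjacent-distinct : ∀ v w → E v w ≡ true → v ≢ w
  adjacent-distinct v w e refl with trans (sym e) (proj₂ simple v)
  ... | ()

  -- The peak set of one labeling: its vertices have degree ≥ 2 and no two are
  -- adjacent (the larger-labelled of two adjacent peaks would beat the other).
  module Admissible (S : Subset n) (admissible : Admissible E S) where

    private
      peak : ∀ s → s ∈ S → IsPeak E (proj₁ admissible) s
      peak s = Equivalence.from (proj₂ (proj₂ admissible) s)

    peak-degree : ∀ s → s ∈ S → 2 ≤ deg E s
    peak-degree s s∈S = proj₁ (peak s s∈S)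

    independent : ∀ s s′ → s ∈ S → s′ ∈ S → E s s′ ≢ true
    independent s s′ s∈S s′∈S e =
      <-asym (proj₂ (peak s s∈S) s′ e) (proj₂ (peak s′ s′∈S) s (adjacent-sym s s′ e))

-- Initial segments of a labeling

module Segments {n : ℕ} (E : Adjacency n) (ℓ : Fin n → ℕ) (labeling : IsLabeling E ℓ) where

  IsInitial : Subset n → Set
  IsInitial W = ∀ w → (w ∈ W → ℓ w ≤ ∣ W ∣) × (ℓ w ≤ ∣ W ∣ → w ∈ W)

  initial-⊤ : IsInitial ⊤
  initial-⊤ w = (λ _ → subst (ℓ w ≤_) (sym (∣⊤∣≡n n)) (proj₂ (proj₁ labeling w))) , (λ _ → ∈⊤)

  outside-above : ∀ {W} → IsInitial W → ∀ {w u} → w ∈ W → u ∉ W → ℓ w < ℓ u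
  outside-above init {w} {u} w∈ u∉ =
    ≤-<-trans (proj₁ (init w) w∈) (≰⇒> (λ ℓu≤ → u∉ (proj₂ (init u) ℓu≤)))

  top-exists : ∀ {W k} → IsInitial W → ∣ W ∣ ≡ suc k → ∃ λ v → v ∈ W × ℓ v ≡ ∣ W ∣
  top-exists {W} init ∣W∣≡ =
    let (v , ℓv) = proj₂ (proj₂ labeling) ∣ W ∣ (subst (1 ≤_) (sym ∣W∣≡) (s≤s z≤n)) (∣p∣≤n W)
    in v , proj₂ (init v) (≤-reflexive ℓv) , ℓv

  remove-top : ∀ {W v} → IsInitial W → v ∈ W → ℓ v ≡ ∣ W ∣ → IsInitial (W - v)
  remove-top {W} {v} init v∈ ℓv w = below , above
    where
    ∣W∣≡ : suc ∣ W - v ∣ ≡ ∣ W ∣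
    ∣W∣≡ = suc∣p-x∣≡∣p∣ W v v∈
    below : w ∈ W - v → ℓ w ≤ ∣ W - v ∣
    below w∈ = ≤-pred (subst (ℓ w <_) (sym ∣W∣≡) (≤∧≢⇒< (proj₁ (init w) (x∈p-y⇒x∈p w∈)) ℓw≢))
      where
      ℓw≢ : ℓ w ≢ ∣ W ∣
      ℓw≢ ℓw≡ = x∈p-y⇒x≢y w∈ (proj₁ (proj₂ labeling) w v (trans ℓw≡ (sym ℓv)))
    above : ℓ w ≤ ∣ W - v ∣ → w ∈ W - v
    above ℓw≤ = x∈p∧x≢y⇒x∈p-y (proj₂ (init w) (≤-trans ℓw≤ (∣p─q∣≤∣p∣ W ⁅ v ⁆))) w≢v
      where
      w≢v : w ≢ v
      w≢v refl = <-irrefl refl (subst (_≤ ∣ W - v ∣) (trans ℓv (sym ∣W∣≡)) ℓw≤)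

  top-above : ∀ {W v w} → IsInitial W → v ∈ W → ℓ v ≡ ∣ W ∣ → w ∈ W → w ≢ v → ℓ w < ℓ v
  top-above {W} {v} {w} init v∈ ℓv w∈ w≢v =
    ≤-<-trans (proj₁ (remove-top init v∈ ℓv w) (x∈p∧x≢y⇒x∈p-y w∈ w≢v))
              (subst (∣ W - v ∣ <_) (sym ℓv) (x∈p⇒∣p-x∣<∣p∣ v∈))

-- How the parameters (S′, L′) of a run relate to the original (S, L)

module Tracking {n : ℕ} (E : Adjacency n) (S L : Subset n) where

  AdjacentToRemoved : Subset n → Fin n → Set
  AdjacentToRemoved W w = ∃ λ u → u ∉ W × E u w ≡ true

  record Tracks (W S′ L′ : Subset n) : Set where
    field
      S′⊆S : ∀ s → s ∈ W → s ∈ S′ → s ∈ S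
      S⊆S′ : ∀ s → s ∈ W → s ∈ S → s ∈ S′
      L′⊆  : ∀ w → w ∈ W → w ∈ L′ → w ∈ L ⊎ AdjacentToRemoved W w
      ⊆L′  : ∀ w → w ∈ W → w ∈ L ⊎ AdjacentToRemoved W w → w ∈ L′

  tracks-⊤ : Tracks ⊤ S L
  tracks-⊤ = record
    { S′⊆S = λ _ _ s∈ → s∈
    ; S⊆S′ = λ _ _ s∈ → s∈
    ; L′⊆  = λ _ _ w∈ → inj₁ w∈
    ; ⊆L′  = λ { _ _ (inj₁ w∈) → w∈ ; _ _ (inj₂ (u , u∉ , _)) → contradiction ∈⊤ u∉ } }

  -- The algorithm's update S′ - v, (L′ ∪ N_W(v)) - v preserves the invariant:
  -- the neighbours of v in W are exactly the vertices newly adjacent to a removed one.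
  tracks-step : ∀ {W S′ L′ v} → v ∈ W → Tracks W S′ L′ →
                Tracks (W - v) (S′ - v) ((L′ ∪ nbrsIn E W v) - v)
  tracks-step {W} {S′} {L′} {v} v∈ tr = record
    { S′⊆S = λ s s∈ s∈S′ → S′⊆S s (x∈p-y⇒x∈p s∈) (x∈p-y⇒x∈p s∈S′)
    ; S⊆S′ = λ s s∈ s∈S → x∈p∧x≢y⇒x∈p-y (S⊆S′ s (x∈p-y⇒x∈p s∈) s∈S) (x∈p-y⇒x≢y s∈)
    ; L′⊆  = new-L′⊆
    ; ⊆L′  = new-⊆L′ }
    where
    open Tracks tr
    new-L′⊆ : ∀ w → w ∈ W - v → w ∈ (L′ ∪ nbrsIn E W v) - v → w ∈ L ⊎ AdjacentToRemoved (W - v) w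
    new-L′⊆ w w∈ w∈L″ with x∈p∪q⁻ L′ (nbrsIn E W v) (x∈p-y⇒x∈p w∈L″)
    ... | inj₂ w∈N = inj₂ (v , x∉p-x W v , ∈-tabulate⁻ (E v) w (proj₁ (x∈p∩q⁻ _ W w∈N)))
    ... | inj₁ w∈L′ with L′⊆ w (x∈p-y⇒x∈p w∈) w∈L′
    ...   | inj₁ w∈L              = inj₁ w∈L
    ...   | inj₂ (u , u∉ , e)     = inj₂ (u , (λ u∈ → u∉ (x∈p-y⇒x∈p u∈)) , e)
    new-⊆L′ : ∀ w → w ∈ W - v → w ∈ L ⊎ AdjacentToRemoved (W - v) w → w ∈ (L′ ∪ nbrsIn E W v) - v
    new-⊆L′ w w∈ adj = x∈p∧x≢y⇒x∈p-y (x∈p∪q⁺ (old adj)) (x∈p-y⇒x≢y w∈)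
      where
      w∈W : w ∈ W
      w∈W = x∈p-y⇒x∈p w∈
      old : w ∈ L ⊎ AdjacentToRemoved (W - v) w → w ∈ L′ ⊎ w ∈ nbrsIn E W v
      old (inj₁ w∈L) = inj₁ (⊆L′ w w∈W (inj₁ w∈L))
      old (inj₂ (u , u∉ , e)) with u ≟F v
      ... | yes refl = inj₂ (x∈p∩q⁺ (∈-tabulate⁺ (E u) w e , w∈W))
      ... | no u≢v   = inj₁ (⊆L′ w w∈W (inj₂ (u , x∉p-y⇒x∉p u∉ u≢v , e)))

-- Soundness: every output of A(G, S, L) lies in P(S, G, L)

module Soundness {n : ℕ} (E : Adjacency n) (simple : IsSimpleGraph E) (S L : Subset n)
                 (ℓ : Fin n → ℕ) (labeling : IsLabeling E ℓ)
                 (peak-degree : ∀ s → s ∈ S → 2 ≤ deg E s)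
                 (independent : ∀ s s′ → s ∈ S → s′ ∈ S → E s s′ ≢ true) where

  open SimpleGraph E simple using (adjacent-sym; adjacent-distinct)
  open Segments E ℓ labeling
  open Tracking E S L

  record Invariant (W S′ L′ : Subset n) : Set where
    field
      initial : IsInitial W
      tracks  : Tracks W S′ L′
      sealed  : ∀ s u → s ∈ S → s ∈ W → u ∉ W → E u s ≢ true

  invariant-⊤ : Invariant ⊤ S L
  invariant-⊤ = record
    { initial = initial-⊤ ; tracks = tracks-⊤ ; sealed = λ _ _ _ _ u∉ _ → u∉ ∈⊤ }

  -- The vertex v removed by the algorithm is not adjacent to S ∩ W: if v ∈ S′ by
  -- independence of S, otherwise by the rule that v ∉ N_W(S′).
  removed-not-adjacent : ∀ {W S′ L′ v} → v ∈ W → (v ∈ S′ ⊎ (v ∈ L′ × ¬ InNbhdIn E W S′ v)) →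
                         Tracks W S′ L′ → ∀ s → s ∈ S → s ∈ W → E v s ≢ true
  removed-not-adjacent v∈ (inj₁ v∈S′) tr s s∈S s∈ e =
    independent _ s (Tracks.S′⊆S tr _ v∈ v∈S′) s∈S e
  removed-not-adjacent v∈ (inj₂ (_ , v∉N[S′])) tr s s∈S s∈ e =
    v∉N[S′] (s , Tracks.S⊆S′ tr s s∈ s∈S , s∈ , v∈ , adjacent-sym _ s e)

  invariant-step : ∀ {W S′ L′ v} → v ∈ W →
                   (v ∈ S′ ⊎ (v ∈ L′ × ¬ InNbhdIn E W S′ v)) → ℓ v ≡ ∣ W ∣ →
                   Invariant W S′ L′ → Invariant (W - v) (S′ - v) ((L′ ∪ nbrsIn E W v) - v)
  invariant-step {W} {S′} {L′} {v} v∈ choice ℓv inv = record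
    { initial = remove-top initial v∈ ℓv
    ; tracks  = tracks-step v∈ tracks
    ; sealed  = new-sealed }
    where
    open Invariant inv
    new-sealed : ∀ s u → s ∈ S → s ∈ W - v → u ∉ W - v → E u s ≢ true
    new-sealed s u s∈S s∈ u∉ with u ≟F v
    ... | no u≢v   = sealed s u s∈S (x∈p-y⇒x∈p s∈) (x∉p-y⇒x∉p u∉ u≢v)
    ... | yes refl = removed-not-adjacent v∈ choice tracks s s∈S (x∈p-y⇒x∈p s∈)

  -- A vertex adjacent to a removed vertex is labelled below it, so is no peak.
  not-peak : ∀ {W v u} → IsInitial W → v ∈ W → u ∉ W → E u v ≡ true → ¬ IsPeak E ℓ v
  not-peak init v∈ u∉ e (_ , beats) = <-asym (beats _ (adjacent-sym _ _ e)) (outside-above init v∈ u∉)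

  -- Every vertex of S is a peak: when it is removed it is the top of W, and all
  -- its neighbours are still in W.
  run-S-peaks : ∀ {W S′ L′} → Alg E W S′ L′ ℓ → Invariant W S′ L′ →
                ∀ v → v ∈ W → v ∈ S → IsPeak E ℓ v
  run-S-peaks (done ℓ refl) _ v v∈ _ = contradiction v∈ ∉⊥
  run-S-peaks {W} (step ℓ v₀ v₀∈ choice ℓv₀ rest) inv v v∈ v∈S with v ≟F v₀
  ... | no v≢v₀ = run-S-peaks rest (invariant-step v₀∈ choice ℓv₀ inv) v (x∈p∧x≢y⇒x∈p-y v∈ v≢v₀) v∈S
  ... | yes refl = peak-degree v v∈S , beats
    where
    open Invariant inv
    beats : ∀ w → E v w ≡ true → ℓ w < ℓ v
    beats w e with w ∈? W
    ... | yes w∈ = top-above initial v∈ ℓv₀ w∈ (λ w≡v → adjacent-distinct v w e (sym w≡v))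
    ... | no w∉  = ⊥-elim (sealed v w v∈S v∈ w∉ (adjacent-sym v w e))

  -- Every peak lies in S or in L ∖ N(S): it was removed either as a vertex of S′
  -- or as a vertex of L′ outside N_W(S′), and a peak has no removed neighbour.
  run-peaks-allowed : ∀ {W S′ L′} → Alg E W S′ L′ ℓ → Invariant W S′ L′ →
                      ∀ v → v ∈ W → IsPeak E ℓ v → v ∈ S ⊎ (v ∈ L × ¬ InNbhdIn E ⊤ S v)
  run-peaks-allowed (done ℓ refl) _ v v∈ _ = contradiction v∈ ∉⊥
  run-peaks-allowed {W} (step ℓ v₀ v₀∈ choice ℓv₀ rest) inv v v∈ peak with v ≟F v₀
  ... | no v≢v₀ =
    run-peaks-allowed rest (invariant-step v₀∈ choice ℓv₀ inv) v (x∈p∧x≢y⇒x∈p-y v∈ v≢v₀) peak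
  ... | yes refl with choice
  ...   | inj₁ v∈S′ = inj₁ (Tracks.S′⊆S (Invariant.tracks inv) v v∈ v∈S′)
  ...   | inj₂ (v∈L′ , v∉N[S′]) with Tracks.L′⊆ (Invariant.tracks inv) v v∈ v∈L′
  ...     | inj₂ (u , u∉ , e) = ⊥-elim (not-peak (Invariant.initial inv) v∈ u∉ e peak)
  ...     | inj₁ v∈L          = inj₂ (v∈L , v∉N[S])
    where
    open Invariant inv
    v∉N[S] : ¬ InNbhdIn E ⊤ S v
    v∉N[S] (s , s∈S , _ , _ , e) with s ∈? W
    ... | yes s∈ = v∉N[S′] (s , Tracks.S⊆S′ tracks s s∈ s∈S , s∈ , v∈ , e)
    ... | no s∉  = not-peak initial v∈ s∉ e peak

alg⇒psl : ∀ {n} (E : Adjacency n) → IsSimpleGraph E → ∀ {S L} → Admissible E S →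
          ∀ {ℓ} → Alg E ⊤ S L ℓ → InPSL E S L ℓ
alg⇒psl E simple {S} {L} admissible {ℓ} run =
  labeling , (λ v v∈S → run-S-peaks run invariant-⊤ v ∈⊤ v∈S)
           , (λ v peak → run-peaks-allowed run invariant-⊤ v ∈⊤ peak)
  where
  labeling : IsLabeling E ℓ
  labeling = Runs.run-labeling E run
  open SimpleGraph.Admissible E simple S admissible
  open Soundness E simple S L ℓ labeling peak-degree independent

-- Completeness: every labeling in P(S, G, L) is an output of A(G, S, L)

module Completeness {n : ℕ} (E : Adjacency n) (simple : IsSimpleGraph E) (S L : Subset n)
                    (deg<2⇒∈L : ∀ v → deg E v < 2 → v ∈ L)
                    (ℓ : Fin n → ℕ) (labeling : IsLabeling E ℓ)
                    (S-peaks : ∀ v → v ∈ S → IsPeak E ℓ v)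
                    (peaks-allowed : ∀ v → IsPeak E ℓ v → v ∈ S ⊎ (v ∈ L × ¬ InNbhdIn E ⊤ S v)) where

  open SimpleGraph E simple using (adjacent-sym; adjacent-distinct)
  open Segments E ℓ labeling
  open Tracking E S L

  -- The top vertex of W is not adjacent to S′: a vertex of S′ in W is a peak,
  -- hence labelled above all its neighbours, but the top label is the largest in W.
  top-∉N[S′] : ∀ {W S′ L′ v} → IsInitial W → Tracks W S′ L′ → ℓ v ≡ ∣ W ∣ → ¬ InNbhdIn E W S′ v
  top-∉N[S′] {v = v} init tr ℓv (s , s∈S′ , s∈ , _ , e) =
    <-irrefl refl (≤-<-trans (subst (ℓ s ≤_) (sym ℓv) (proj₁ (init s) s∈))
                             (proj₂ (S-peaks s (Tracks.S′⊆S tr s s∈ s∈S′)) v e))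

  -- The top vertex of W, if not in S, is in L′.  Otherwise it lies neither in L
  -- nor next to a removed vertex; then all its neighbours are in W and labelled
  -- below it, so it has degree ≥ 2 (degree < 2 forces it into L) and is a peak
  -- outside S ∪ L, which ℓ ∈ P(S, G, L) excludes.
  top-∈L′ : ∀ {W S′ L′ v} → IsInitial W → Tracks W S′ L′ → v ∈ W → ℓ v ≡ ∣ W ∣ →
            v ∉ S → v ∈ L′
  top-∈L′ {W} {S′} {L′} {v} init tr v∈ ℓv v∉S with v ∈? L′
  ... | yes v∈L′ = v∈L′
  ... | no v∉L′  = ⊥-elim (not-a-peak peak)
    where
    open Tracks tr
    v∉L : v ∉ L
    v∉L v∈L = v∉L′ (⊆L′ v v∈ (inj₁ v∈L))
    beats : ∀ w → E v w ≡ true → ℓ w < ℓ v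
    beats w e with w ∈? W
    ... | yes w∈ = top-above init v∈ ℓv w∈ (λ w≡v → adjacent-distinct v w e (sym w≡v))
    ... | no w∉  = ⊥-elim (v∉L′ (⊆L′ v v∈ (inj₂ (w , w∉ , adjacent-sym v w e))))
    peak : IsPeak E ℓ v
    peak with 2 ≤? deg E v
    ... | yes 2≤deg = 2≤deg , beats
    ... | no 2≰deg  = ⊥-elim (v∉L (deg<2⇒∈L v (≰⇒> 2≰deg)))
    not-a-peak : ¬ IsPeak E ℓ v
    not-a-peak pk with peaks-allowed v pk
    ... | inj₁ v∈S       = v∉S v∈S
    ... | inj₂ (v∈L , _) = v∉L v∈L

  top-allowed : ∀ {W S′ L′ v} → IsInitial W → Tracks W S′ L′ → v ∈ W → ℓ v ≡ ∣ W ∣ →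
                v ∈ S′ ⊎ (v ∈ L′ × ¬ InNbhdIn E W S′ v)
  top-allowed {v = v} init tr v∈ ℓv with v ∈? S
  ... | yes v∈S = inj₁ (Tracks.S⊆S′ tr v v∈ v∈S)
  ... | no v∉S  = inj₂ (top-∈L′ init tr v∈ ℓv v∉S , top-∉N[S′] init tr ℓv)

  build : ∀ k {W S′ L′} → ∣ W ∣ ≡ k → IsInitial W → Tracks W S′ L′ → Alg E W S′ L′ ℓ
  build zero {W} ∣W∣≡0 init tr = done ℓ (Empty-unique no-vertex)
    where
    no-vertex : ¬ ∃ λ w → w ∈ W
    no-vertex (w , w∈) =
      contradiction (≤-trans (proj₁ (proj₁ labeling w)) (subst (ℓ w ≤_) ∣W∣≡0 (proj₁ (init w) w∈))) λ ()
  build (suc k) {W} ∣W∣≡ init tr =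
    let (v , v∈ , ℓv) = top-exists init ∣W∣≡
    in step ℓ v v∈ (top-allowed init tr v∈ ℓv) ℓv
         (build k (suc-injective (trans (suc∣p-x∣≡∣p∣ W v v∈) ∣W∣≡))
                  (remove-top init v∈ ℓv) (tracks-step v∈ tr))

psl⇒alg : ∀ {n} (E : Adjacency n) → IsSimpleGraph E → ∀ {S L} →
          (∀ v → deg E v < 2 → v ∈ L) → ∀ {ℓ} → InPSL E S L ℓ → Alg E ⊤ S L ℓ
psl⇒alg {n} E simple {S} {L} deg<2⇒∈L {ℓ} (labeling , S-peaks , peaks-allowed) =
  build n (∣⊤∣≡n n) initial-⊤ tracks-⊤
  where
  open Completeness E simple S L deg<2⇒∈L ℓ labeling S-peaks peaks-allowed
  open Segments E ℓ labeling using (initial-⊤)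
  open Tracking E S L using (tracks-⊤)

theorem2p6 : (n : ℕ) (E : Adjacency n) → IsSimpleGraph E →
    (S L : Subset n) → Admissible E S →
    (∀ (v : Fin n) → deg E v < 2 → v ∈ L) →
    (ℓ : Fin n → ℕ) → (Alg E ⊤ S L ℓ ⇔ InPSL E S L ℓ)
theorem2p6 n E simple S L admissible deg<2⇒∈L ℓ =
  mk⇔ (alg⇒psl E simple admissible) (psl⇒alg E simple deg<2⇒∈L)
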